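{- Let $p$ be a prime, $k\ge1$ an integer and $l_0>0$ real. The function $t\mapsto\prod_{l<l_0,\ l\text{ prime}}v_{l,k}(t^2-4p)$ on $\mathbb{Z}$ is periodic with period dividing $T=\left(\prod_{l<l_0,\ l\text{ prime}}l\right)^{2k}$, and $T=O(2^{4kl_0})$. Furthermore, if $t$ is chosen uniformly at random from any set of $T$ consecutive integers, the random variables $v_{l,k}(t^2-4p)$, $l<l_0$ prime, are mutually independent.
   Context: For a nonzero integer $\Delta$ and a prime $l$, let $\delta$ be the largest non-negative integer with $l^{2\delta}\mid\Delta$, where for $l=2$ one additionally requires $\Delta/2^{2\delta}\equiv 0,1\pmod 4$. Define $v_l(\Delta)=(1-l^{ -2})^{ -1}(1+l^{ -1}+c)$ where $c=0$, $c=-(l+1)l^{ -\delta-2}$, or $c=-2l^{ -\delta-1}$ according as the Kronecker symbol $\left(\frac{\Delta/l^{2\delta}}{l}\right)$ equals $+1$, $0$, or $-1$. For an integer $k\ge1$, $v_{l,k}(\Delta)=v_l(\Delta)$ if $\Delta\not\equiv0\pmod{l^{2k}}$ and $v_{l,k}(\Delta)=(1-l^{ -2})^{ -1}(1+l^{ -1})$ if $\Delta\equiv0\pmod{l^{2k}}$.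
   Formalization: The cut-off $l_0$ ranges over the positive rationals rather than the positive reals. -}

module Defs where

open import Data.Bool using (T?; Bool; true; false; if_then_else_; _∧_; _∨_; not)
open import Data.Nat as ℕ using (ℕ; zero; suc; _∸_; _^_; _≡ᵇ_)
import Data.Nat.DivMod as ℕD
open import Data.Nat.Divisibility using (_∣?_)
open import Data.Nat.Primality using (prime?)
open import Data.Integer as ℤ using (ℤ; +_; -[1+_]; ∣_∣; sign; _◃_)
open import Data.Rational as ℚ using (ℚ; 0ℚ; 1ℚ; ≢-nonZero; 1/_)
import Data.Rational.Properties as ℚP
open import Data.List using (List; []; _∷_; filter; upTo; map; length; foldr)
open import Data.Nat.ListAction using (product)
open import Data.Bool.ListAction using (any; all)
open import Relation.Nullary using (yes; no; does)

divN : ℕ → ℕ → ℕ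
divN m zero    = 0
divN m (suc n) = m ℕD./ suc n

modN : ℕ → ℕ → ℕ
modN m zero    = m
modN m (suc n) = m ℕD.% suc n

modZ : ℤ → ℕ → ℕ
modZ x zero    = 0
modZ x (suc n) = x ℤ.%ℕ suc n

-- multiplicative inverse on ℚ (only ever applied to nonzero values)
inv : ℚ → ℚ
inv p with p ℚP.≟ 0ℚ
... | yes _ = 0ℚ
... | no ne = 1/_ p {{≢-nonZero ne}}

fromZ : ℤ → ℚ
fromZ z = z ℚ./ 1

frac : ℤ → ℕ → ℚ
frac a b = fromZ a ℚ.* inv (fromZ (+ b))

isSquareMod : ℤ → ℕ → Bool
isSquareMod D l = any (λ x → modN (x ℕ.* x) l ≡ᵇ modZ D l) (upTo l)

kronecker : ℤ → ℕ → ℤ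
kronecker D l =
  if l ≡ᵇ 2
  then (if (modZ D 8 ≡ᵇ 1) ∨ (modZ D 8 ≡ᵇ 7) then ℤ.+ 1
        else if (modZ D 8 ≡ᵇ 3) ∨ (modZ D 8 ≡ᵇ 5) then ℤ.- (ℤ.+ 1)
        else ℤ.+ 0)
  else (if modZ D l ≡ᵇ 0 then ℤ.+ 0
        else if isSquareMod D l then ℤ.+ 1 else ℤ.- (ℤ.+ 1))

divZ : ℤ → ℕ → ℤ
divZ Δ m = sign Δ ◃ divN ∣ Δ ∣ m

δ-ok : ℕ → ℤ → ℕ → Bool
δ-ok l Δ d =
  does ((l ^ (2 ℕ.* d)) ∣? ∣ Δ ∣)
  ∧ (if l ≡ᵇ 2
     then (modZ (divZ Δ (l ^ (2 ℕ.* d))) 4 ≡ᵇ 0)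
          ∨ (modZ (divZ Δ (l ^ (2 ℕ.* d))) 4 ≡ᵇ 1)
     else true)

largestUpTo : (ℕ → Bool) → ℕ → ℕ
largestUpTo P zero    = 0
largestUpTo P (suc n) = if P (suc n) then suc n else largestUpTo P n

-- For Δ ≠ 0 and l ≥ 2 any admissible d satisfies d ≤ |Δ|, so this is
-- the largest admissible d.
δ : ℕ → ℤ → ℕ
δ l Δ = largestUpTo (δ-ok l Δ) ∣ Δ ∣

lQ : ℕ → ℚ
lQ l = fromZ (+ l)

factor : ℕ → ℚ
factor l = inv (1ℚ ℚ.- inv (lQ l ℚ.* lQ l))

lpowInv : ℕ → ℕ → ℚ
lpowInv l n = inv (fromZ (+ (l ^ n)))

v : ℕ → ℤ → ℚ
v l Δ = factor l ℚ.* (1ℚ ℚ.+ inv (lQ l) ℚ.+ c)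
  where
    d = δ l Δ
    κ = kronecker (divZ Δ (l ^ (2 ℕ.* d))) l
    c : ℚ
    c = if does (κ ℤ.≟ ℤ.+ 1) then 0ℚ
        else if does (κ ℤ.≟ ℤ.+ 0)
             then ℚ.- (lQ (l ℕ.+ 1) ℚ.* lpowInv l (d ℕ.+ 2))
             else ℚ.- (fromZ (+ 2) ℚ.* lpowInv l (d ℕ.+ 1))

v-k : ℕ → ℕ → ℤ → ℚ
v-k l k Δ =
  if does ((l ^ (2 ℕ.* k)) ∣? ∣ Δ ∣)
  then factor l ℚ.* (1ℚ ℚ.+ inv (lQ l))
  else v l Δ

-- Primes l < l₀ where l₀ = a / b (a, b > 0), i.e. l · b < a.

primesBelow : ℕ → ℕ → List ℕ
primesBelow a b = filter (λ l → prime? l) (filter (λ l → (l ℕ.* b) ℕ.<? a) (upTo a))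

periodT : ℕ → ℕ → ℕ → ℕ
periodT k a b = product (primesBelow a b) ^ (2 ℕ.* k)

disc : ℕ → ℤ → ℤ
disc p t = t ℤ.* t ℤ.- ℤ.+ (4 ℕ.* p)

F : ℕ → ℕ → ℕ → ℕ → ℤ → ℚ
F p k a b t = foldr (λ l acc → v-k l k (disc p t) ℚ.* acc) 1ℚ (primesBelow a b)

window : ℤ → ℕ → List ℤ
window s n = map (λ i → s ℤ.+ + i) (upTo n)

countJoint : ℕ → ℕ → List ℕ → (ℕ → ℚ) → List ℤ → ℕ
countJoint p k L x W =
  length (filter (λ t → T? (all (λ l → does (v-k l k (disc p t) ℚP.≟ x l)) L)) W)


countOne : ℕ → ℕ → ℕ → ℚ → List ℤ → ℕ
countOne p k l y W = length (filter (λ t → v-k l k (disc p t) ℚP.≟ y) W)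

productOfCounts : ℕ → ℕ → List ℕ → (ℕ → ℚ) → List ℤ → ℕ
productOfCounts p k L x W = product (map (λ l → countOne p k l (x l) W) L)

-- For a prime l, v_{l,k}(Δ) is determined by Δ modulo l^{2k} (modulo 2^{2k+1} if l = 2):
-- whether l^{2k} divides Δ, the exponent δ < k and the Kronecker symbol of Δ / l^{2δ} can
-- all be read off from that residue.  Since (t + u)² − 4p ≡ t² − 4p modulo u (modulo 2u
-- for even u), t ↦ v_{l,k}(t² − 4p) has period l^{2k}, and F has period T = ∏_{l < l₀} l^{2k}.
-- Independence is the Chinese remainder theorem for sums: if f has period m, g has period n
-- and m, n are coprime, then ∑_{i < mn} f(i) g(i) = (∑_{i < m} f(i)) (∑_{i < n} g(i));
-- apply it to the indicators of the events v_{l,k}(t² − 4p) = x_l.  Finally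
-- ∏_{l < l₀} l ≤ 4^{l₀} by Erdős' bound ∏_{p ≤ n} p ≤ 4^n (the primes in (m + 1, 2m + 1]
-- divide binom(2m + 1, m) ≤ 4^m), so T ≤ 2^{4 k l₀}.

module Submission where

open import Defs
open import Data.Nat using (ℕ; _≤_; _*_; _^_; _+_)
open import Data.Nat.Primality using (Prime)
open import Data.Integer using (ℤ; +_)
open import Data.Rational using (ℚ)
open import Data.List using (length)
open import Data.Product using (_×_; ∃)
open import Relation.Binary.PropositionalEquality using (_≡_)

open import Algebra.Properties.CommutativeSemigroup using (interchange)
open import Data.Bool using (Bool; true; false; if_then_else_; _∧_; _∨_; T)
open import Data.Bool.Properties using (∧-conicalˡ)
open import Data.Bool.ListAction using (any; all)
open import Data.Empty using (⊥-elim)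
open import Data.Integer as ℤ using (-_; sign; _◃_; ∣_∣)
import Data.Integer.Properties as ℤ
open import Data.Integer.DivMod using (a≡a%ℕn+[a/ℕn]*n; n%ℕd<d)
open import Data.Integer.Divisibility.Signed as ℤ∣ using (∣ᵤ⇒∣; ∣⇒∣ᵤ)
  renaming (_∣_ to _∣ℤ_)
import Data.Integer.Tactic.RingSolver as ℤ-Solver
open import Data.List.Base using (List; []; _∷_; map; foldr; filter; upTo; applyUpTo)
open import Data.List.Properties using (map-upTo; map-cong-local)
open import Data.List.Membership.Propositional using (_∈_)
open import Data.List.Membership.Propositional.Properties
  using (∈-filter⁺; ∈-filter⁻; ∈-upTo⁺; ∈-upTo⁻; ∈-map⁺)
open import Data.List.Relation.Unary.All as All using (All; []; _∷_)
open import Data.List.Relation.Unary.All.Properties as Allₚ using (all-filter)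
open import Data.List.Relation.Unary.AllPairs using (AllPairs; []; _∷_)
open import Data.List.Relation.Unary.Unique.Propositional using (Unique)
import Data.List.Relation.Unary.Unique.Propositional.Properties as Unique
open import Data.Nat
open import Data.Nat.Combinatorics
  using (_C_; nC1≡n; nCn≡1; nCk≡nC[n∸k]; nCk+nC[k+1]≡[n+1]C[k+1]; k![n∸k]!∣n!)
open import Data.Nat.Combinatorics.Specification using (nCk≡n!/k![n-k]!)
open import Data.Nat.Coprimality as Coprimality using (Coprime; coprime-divisor; coprime-Bézout)
open import Data.Nat.Divisibility
open import Data.Nat.DivMod using (m*n/n≡m; m/n*n≡m; m/n*n≤m; /-monoˡ-≤)
open import Data.Nat.GCD using (module Bézout)
open import Data.Nat.Induction using (<-rec)
open import Data.Nat.ListAction using (product)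
open import Data.Nat.ListAction.Properties using (∈⇒∣product)
open import Data.Nat.Primality
open import Data.Nat.Properties
import Data.Nat.Tactic.RingSolver as ℕ-Solver
open import Data.Product using (_,_; proj₁; proj₂)
open import Data.Rational as ℚ using (0ℚ; 1ℚ)
import Data.Sign as Sign
import Data.Sign.Properties as Sign
open import Data.Sum using (_⊎_; inj₁; inj₂; [_,_]′)
open import Function using (id; _∘_)
open import Relation.Nullary using (¬_; Dec; yes; no; does; proof)
open import Relation.Nullary.Decidable using (T?)
open import Relation.Nullary.Negation using (contradiction)
open import Relation.Nullary.Reflects using (Reflects; invert)
open import Relation.Binary.PropositionalEquality

n<2^n : ∀ n → n < 2 ^ n
n<2^n zero    = z<s
n<2^n (suc n) = +-mono-≤ (m^n>0 2 n) (≤-trans (n<2^n n) (≤-reflexive (sym (+-identityʳ (2 ^ n)))))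

^-monoʳ-∣ : ∀ l {m n} → m ≤ n → l ^ m ∣ l ^ n
^-monoʳ-∣ l {m} {n} m≤n =
  divides (l ^ (n ∸ m)) (trans (cong (l ^_) (sym (m∸n+n≡m m≤n))) (^-distribˡ-+-* l (n ∸ m) m))

^-*-^-∣ : ∀ l {a b n} → a + b ≤ n → l ^ a * l ^ b ∣ l ^ n
^-*-^-∣ l {a} {b} {n} a+b≤n = subst (_∣ l ^ n) (^-distribˡ-+-* l a b) (^-monoʳ-∣ l a+b≤n)

^-distribʳ-* : ∀ m n e → (m * n) ^ e ≡ m ^ e * n ^ e
^-distribʳ-* m n zero    = refl
^-distribʳ-* m n (suc e) =
  trans (cong (_*_ (m * n)) (^-distribʳ-* m n e)) (interchange *-commutativeSemigroup m n _ _)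

product-^ : ∀ ns e → product ns ^ e ≡ product (map (_^ e) ns)
product-^ []       e = ^-zeroˡ e
product-^ (n ∷ ns) e = trans (^-distribʳ-* n (product ns) e) (cong (_*_ (n ^ e)) (product-^ ns e))

product-map-* : ∀ {A : Set} (f g : A → ℕ) xs →
                product (map (λ x → f x * g x) xs) ≡ product (map f xs) * product (map g xs)
product-map-* f g []       = refl
product-map-* f g (x ∷ xs) =
  trans (cong (_*_ (f x * g x)) (product-map-* f g xs)) (interchange *-commutativeSemigroup (f x) (g x) _ _)

product-map-const : ∀ {A : Set} c (xs : List A) → product (map (λ _ → c) xs) ≡ c ^ length xs
product-map-const c []       = refl
product-map-const c (x ∷ xs) = cong (_*_ c) (product-map-const c xs)

divN-* : ∀ {m n} → m ∣ n → divN n m * m ≡ n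
divN-* {zero}  {n} 0∣n = sym (0∣⇒≡0 0∣n)
divN-* {suc m}     m∣n = m/n*n≡m m∣n

coprime-* : ∀ {m a b} → Coprime m a → Coprime m b → Coprime m (a * b)
coprime-* m⊥a m⊥b (d∣m , d∣ab) =
  m⊥b (d∣m , coprime-divisor (λ (e∣d , e∣a) → m⊥a (∣-trans e∣d d∣m , e∣a)) d∣ab)

coprime-product : ∀ {m ns} → All (Coprime m) ns → Coprime m (product ns)
coprime-product []           = Coprimality.sym (Coprimality.1-coprimeTo _)
coprime-product (m⊥n ∷ m⊥ns) = coprime-* m⊥n (coprime-product m⊥ns)

coprime-^ʳ : ∀ {m n} → Coprime m n → ∀ e → Coprime m (n ^ e)
coprime-^ʳ m⊥n zero    = Coprimality.sym (Coprimality.1-coprimeTo _)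
coprime-^ʳ m⊥n (suc e) = coprime-* m⊥n (coprime-^ʳ m⊥n e)

coprime-^ : ∀ {m n} → Coprime m n → ∀ e → Coprime (m ^ e) (n ^ e)
coprime-^ m⊥n e = Coprimality.sym (coprime-^ʳ (Coprimality.sym (coprime-^ʳ m⊥n e)) e)

coprime-∣⇒*∣ : ∀ {m n x} → Coprime m n → m ∣ x → n ∣ x → m * n ∣ x
coprime-∣⇒*∣ {m} {n} m⊥n m∣x (divides c refl) =
  *-monoˡ-∣ n (coprime-divisor m⊥n (subst (m ∣_) (*-comm c n) m∣x))

prime≢1 : ∀ {p} → Prime p → p ≢ 1
prime≢1 p-prime = nonTrivial⇒≢1 {{prime⇒nonTrivial p-prime}}

prime≥2 : ∀ {p} → Prime p → 2 ≤ p
prime≥2 {p} p-prime = nonTrivial⇒n>1 p {{prime⇒nonTrivial p-prime}}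

distinct-primes-coprime : ∀ {p q} → Prime p → Prime q → p ≢ q → Coprime p q
distinct-primes-coprime p-prime q-prime p≢q (d∣p , d∣q) with prime⇒irreducible p-prime d∣p
... | inj₁ d≡1 = d≡1
... | inj₂ refl with prime⇒irreducible q-prime d∣q
...   | inj₁ p≡1 = contradiction p≡1 (prime≢1 p-prime)
...   | inj₂ p≡q = contradiction p≡q p≢q

coprime-to-other-primes : ∀ {p qs} → Prime p → All (p ≢_) qs → All Prime qs → All (Coprime p) qs
coprime-to-other-primes p-prime []           []                 = []
coprime-to-other-primes p-prime (p≢q ∷ p∉qs) (q-prime ∷ primes) =
  distinct-primes-coprime p-prime q-prime p≢q ∷ coprime-to-other-primes p-prime p∉qs primes

coprime-prime-powers : ∀ e {ps} → Unique ps → All Prime ps →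
                       AllPairs (λ p q → Coprime (p ^ e) (q ^ e)) ps
coprime-prime-powers e []                       []                 = []
coprime-prime-powers e {p ∷ _} (p∉ps ∷ ps!) (p-prime ∷ primes) =
  All.map {P = Coprime p} {Q = λ q → Coprime (p ^ e) (q ^ e)} (λ p⊥q → coprime-^ p⊥q e)
          (coprime-to-other-primes p-prime p∉ps primes)
  ∷ coprime-prime-powers e ps! primes

product-distinct-primes-∣ : ∀ {ps x} → Unique ps → All Prime ps → All (_∣ x) ps → product ps ∣ x
product-distinct-primes-∣ {x = x} []           []                 []           = 1∣ x
product-distinct-primes-∣         (p∉ps ∷ ps!) (p-prime ∷ primes) (p∣x ∷ ps∣x) =
  coprime-∣⇒*∣ (coprime-product (coprime-to-other-primes p-prime p∉ps primes))
               p∣x (product-distinct-primes-∣ ps! primes ps∣x)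

-- The primorial bound

∣-! : ∀ {p n} → 0 < p → p ≤ n → p ∣ n !
∣-! {suc p} 0<p p≤n = ∣-trans (m∣m*n (p !)) (m≤n⇒m!∣n! p≤n)

prime∣!⇒≤ : ∀ {p} n → Prime p → p ∣ n ! → p ≤ n
prime∣!⇒≤ zero    p-prime p∣1  = contradiction (∣1⇒≡1 p∣1) (prime≢1 p-prime)
prime∣!⇒≤ (suc n) p-prime p∣n! with euclidsLemma (suc n) (n !) p-prime p∣n!
... | inj₁ p∣1+n = ∣⇒≤ p∣1+n
... | inj₂ p∣n!′ = m≤n⇒m≤1+n (prime∣!⇒≤ n p-prime p∣n!′)

prime∤! : ∀ {p n} → Prime p → n < p → p ∤ n !
prime∤! p-prime n<p p∣n! = <⇒≱ n<p (prime∣!⇒≤ _ p-prime p∣n!)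

binomial-*-factorials : ∀ {n k} → k ≤ n → (n C k) * (k ! * (n ∸ k) !) ≡ n !
binomial-*-factorials {n} {k} k≤n = begin
  (n C k) * (k ! * (n ∸ k) !)                      ≡⟨ cong (_* (k ! * (n ∸ k) !)) (nCk≡n!/k![n-k]! k≤n) ⟩
  (n ! / (k ! * (n ∸ k) !)) * (k ! * (n ∸ k) !)  ≡⟨ m/n*n≡m (k![n∸k]!∣n! k≤n) ⟩
  n !                                              ∎
  where
  open ≡-Reasoning
  instance
    _ : NonZero (k ! * (n ∸ k) !)
    _ = k !* (n ∸ k) !≢0

binomial≢0 : ∀ {n k} → k ≤ n → NonZero (n C k)
binomial≢0 {n} {k} k≤n = ≢-nonZero λ C≡0 → ≢-nonZero⁻¹ (n !) {{n !≢0}}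
  (trans (sym (binomial-*-factorials k≤n)) (cong (_* (k ! * (n ∸ k) !)) C≡0))

binomial-≤ : ∀ n k → k < n → suc n C suc k ≤ 2 ^ n
binomial-≤ (suc n) zero    _         = ≤-trans (≤-reflexive (nC1≡n (suc (suc n)))) (n<2^n (suc n))
binomial-≤ (suc n) (suc k) (s≤s k<n) = begin
  suc (suc n) C suc (suc k)              ≡⟨ nCk+nC[k+1]≡[n+1]C[k+1] (suc n) (suc k) ⟨
  suc n C suc k + suc n C suc (suc k)    ≤⟨ +-mono-≤ (binomial-≤ n k k<n) upper ⟩
  2 ^ n + 2 ^ n                          ≡⟨ cong (_+_ (2 ^ n)) (+-identityʳ (2 ^ n)) ⟨
  2 ^ suc n                              ∎
  where
  open ≤-Reasoning
  upper : suc n C suc (suc k) ≤ 2 ^ n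
  upper with m≤n⇒m<n∨m≡n k<n
  ... | inj₁ 1+k<n = binomial-≤ n (suc k) 1+k<n
  ... | inj₂ refl  = ≤-trans (≤-reflexive (nCn≡1 (suc n))) (m^n>0 2 n)

central-binomial-≤ : ∀ m → (m + suc m) C m ≤ 4 ^ m
central-binomial-≤ m = *-cancelˡ-≤ 2 (begin
  2 * c                    ≡⟨ cong (_+_ c) (trans (+-identityʳ c) (sym symmetric)) ⟩
  c + (m + suc m) C suc m  ≡⟨ nCk+nC[k+1]≡[n+1]C[k+1] (m + suc m) m ⟩
  suc (m + suc m) C suc m  ≤⟨ binomial-≤ (m + suc m) m (m<m+n m z<s) ⟩
  2 ^ (m + suc m)          ≡⟨ cong (2 ^_) (trans (+-suc m m) (cong (suc ∘ (_+_ m)) (sym (+-identityʳ m)))) ⟩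
  2 * 2 ^ (2 * m)          ≡⟨ cong (2 *_) (^-*-assoc 2 2 m) ⟨
  2 * 4 ^ m                ∎)
  where
  open ≤-Reasoning
  c : ℕ
  c = (m + suc m) C m
  symmetric : (m + suc m) C suc m ≡ c
  symmetric = trans (nCk≡nC[n∸k] (m≤n+m (suc m) m)) (cong ((m + suc m) C_) (m+n∸n≡m m (suc m)))

prime∣central-binomial : ∀ {p} m → Prime p → suc m < p → p ≤ m + suc m → p ∣ (m + suc m) C m
prime∣central-binomial {p} m p-prime 1+m<p p≤2m+1
  with euclidsLemma ((m + suc m) C m) (m ! * (m + suc m ∸ m) !) p-prime
         (subst (p ∣_) (sym (binomial-*-factorials (m≤m+n m (suc m)))) (∣-! (<-trans z<s 1+m<p) p≤2m+1))
... | inj₁ p∣C          = p∣C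
... | inj₂ p∣factorials = ⊥-elim ([ prime∤! p-prime (<-trans (n<1+n m) 1+m<p)
                                  , prime∤! p-prime (subst (_< p) (sym (m+n∸m≡n m (suc m))) 1+m<p)
                                  ]′ (euclidsLemma (m !) _ p-prime p∣factorials))

primorial : ℕ → ℕ
primorial n = product (filter prime? (upTo (suc n)))

prime∣primorial : ∀ {p n} → Prime p → p ≤ n → p ∣ primorial n
prime∣primorial p-prime p≤n = ∈⇒∣product (∈-filter⁺ prime? (∈-upTo⁺ (s≤s p≤n)) p-prime)

primorial-∣ : ∀ {n x} → (∀ {p} → Prime p → p ≤ n → p ∣ x) → primorial n ∣ x
primorial-∣ {n} primes∣x = product-distinct-primes-∣
  (Unique.filter⁺ prime? (Unique.upTo⁺ (suc n)))
  (all-filter prime? (upTo (suc n)))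
  (All.tabulate λ p∈ → let p∈upTo , p-prime = ∈-filter⁻ prime? p∈
                        in primes∣x p-prime (≤-pred (∈-upTo⁻ p∈upTo)))

primorial≢0 : ∀ n → NonZero (primorial n)
primorial≢0 n = productOfPrimes≢0 (all-filter prime? (upTo (suc n)))

primorial-suc-∣ : ∀ {n} → ¬ Prime (suc n) → primorial (suc n) ∣ primorial n
primorial-suc-∣ {n} ¬prime = primorial-∣ λ p-prime p≤1+n → prime∣primorial p-prime (below p-prime p≤1+n)
  where
  below : ∀ {p} → Prime p → p ≤ suc n → p ≤ n
  below p-prime p≤1+n with m≤n⇒m<n∨m≡n p≤1+n
  ... | inj₁ p<1+n = ≤-pred p<1+n
  ... | inj₂ refl  = contradiction p-prime ¬prime

primorial-odd-∣ : ∀ m → primorial (m + suc m) ∣ primorial (suc m) * ((m + suc m) C m)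
primorial-odd-∣ m = primorial-∣ λ {p} p-prime p≤2m+1 → split p-prime p≤2m+1 (p ≤? suc m)
  where
  split : ∀ {p} → Prime p → p ≤ m + suc m → Dec (p ≤ suc m) → p ∣ primorial (suc m) * ((m + suc m) C m)
  split p-prime _      (yes p≤1+m) = ∣m⇒∣m*n _ (prime∣primorial p-prime p≤1+m)
  split p-prime p≤2m+1 (no p≰1+m)  =
    ∣n⇒∣m*n (primorial (suc m)) (prime∣central-binomial m p-prime (≰⇒> p≰1+m) p≤2m+1)

¬prime-double : ∀ k → 2 ≤ k → ¬ Prime (k + k)
¬prime-double k 2≤k k+k-prime
  with prime⇒irreducible k+k-prime (divides k (trans (cong (_+_ k) (sym (+-identityʳ k))) (*-comm 2 k)))
... | inj₁ ()
... | inj₂ 2≡k+k = <⇒≢ (+-mono-≤ 2≤k (≤-trans (s≤s z≤n) 2≤k)) 2≡k+k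

data EvenOrOdd : ℕ → Set where
  even : ∀ m → EvenOrOdd (m + m)
  odd  : ∀ m → EvenOrOdd (m + suc m)

evenOrOdd : ∀ n → EvenOrOdd n
evenOrOdd zero    = even zero
evenOrOdd (suc n) with evenOrOdd n
... | even m = subst EvenOrOdd (+-suc m m) (odd m)
... | odd m  = even (suc m)

primorial-≤ : ∀ n → primorial n ≤ 4 ^ n
primorial-≤ = <-rec _ λ n rec → bound rec (evenOrOdd n)
  where
  bound : ∀ {n} → (∀ {m} → m < n → primorial m ≤ 4 ^ m) → EvenOrOdd n → primorial n ≤ 4 ^ n
  bound rec (even 0)             = ≤-refl
  bound rec (even 1)             = s≤s (s≤s z≤n)
  bound rec (even (suc (suc m))) = begin
    primorial (suc n′)  ≤⟨ ∣⇒≤ {{primorial≢0 n′}} (primorial-suc-∣ (¬prime-double (2 + m) (s≤s (s≤s z≤n)))) ⟩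
    primorial n′        ≤⟨ rec (n<1+n n′) ⟩
    4 ^ n′              ≤⟨ ^-monoʳ-≤ 4 (n≤1+n n′) ⟩
    4 ^ suc n′          ∎
    where
    open ≤-Reasoning
    n′ : ℕ
    n′ = suc m + suc (suc m)
  bound rec (odd 0)              = s≤s z≤n
  bound rec (odd m@(suc _))      = begin
    primorial (m + suc m)                   ≤⟨ ∣⇒≤ {{≢0}} (primorial-odd-∣ m) ⟩
    primorial (suc m) * ((m + suc m) C m)   ≤⟨ *-mono-≤ (rec (s≤s (m≤n+m (suc m) _))) (central-binomial-≤ m) ⟩
    4 ^ suc m * 4 ^ m                       ≡⟨ ^-distribˡ-+-* 4 (suc m) m ⟨
    4 ^ (suc m + m)                         ≡⟨ cong (4 ^_) (+-comm (suc m) m) ⟩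
    4 ^ (m + suc m)                         ∎
    where
    open ≤-Reasoning
    ≢0 : NonZero (primorial (suc m) * ((m + suc m) C m))
    ≢0 = m*n≢0 _ _ {{primorial≢0 (suc m)}} {{binomial≢0 (m≤m+n m (suc m))}}

-- Sums over initial segments of ℕ and periodic functions

sumBelow : ℕ → (ℕ → ℕ) → ℕ
sumBelow zero    f = 0
sumBelow (suc n) f = f 0 + sumBelow n (f ∘ suc)

syntax sumBelow n (λ i → e) = ∑[ i < n ] e

∑-cong : ∀ {f g : ℕ → ℕ} n → (∀ i → f i ≡ g i) → ∑[ i < n ] f i ≡ ∑[ i < n ] g i
∑-cong zero    f≗g = refl
∑-cong (suc n) f≗g = cong₂ _+_ (f≗g 0) (∑-cong n (λ i → f≗g (suc i)))

∑-const : ∀ n c → ∑[ i < n ] c ≡ n * c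
∑-const zero    c = refl
∑-const (suc n) c = cong (_+_ c) (∑-const n c)

∑-distrib-+ : ∀ f g n → ∑[ i < n ] (f i + g i) ≡ ∑[ i < n ] f i + ∑[ i < n ] g i
∑-distrib-+ f g zero    = refl
∑-distrib-+ f g (suc n) = trans (cong (_+_ (f 0 + g 0)) (∑-distrib-+ (f ∘ suc) (g ∘ suc) n))
                                (interchange +-commutativeSemigroup (f 0) (g 0) _ _)

∑-*ˡ : ∀ c f n → ∑[ i < n ] (c * f i) ≡ c * ∑[ i < n ] f i
∑-*ˡ c f zero    = sym (*-zeroʳ c)
∑-*ˡ c f (suc n) = trans (cong (_+_ (c * f 0)) (∑-*ˡ c (f ∘ suc) n)) (sym (*-distribˡ-+ c (f 0) _))

∑-*ʳ : ∀ f c n → ∑[ i < n ] (f i * c) ≡ (∑[ i < n ] f i) * c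
∑-*ʳ f c zero    = refl
∑-*ʳ f c (suc n) = trans (cong (_+_ (f 0 * c)) (∑-*ʳ (f ∘ suc) c n)) (sym (*-distribʳ-+ c (f 0) _))

∑-+ : ∀ f m n → ∑[ i < m + n ] f i ≡ ∑[ i < m ] f i + ∑[ i < n ] f (m + i)
∑-+ f zero    n = refl
∑-+ f (suc m) n = trans (cong (_+_ (f 0)) (∑-+ (f ∘ suc) m n)) (sym (+-assoc (f 0) _ _))

∑-comm : ∀ (f : ℕ → ℕ → ℕ) m n →
         ∑[ i < m ] ∑[ j < n ] f i j ≡ ∑[ j < n ] ∑[ i < m ] f i j
∑-comm f zero    n = sym (trans (∑-const n 0) (*-zeroʳ n))
∑-comm f (suc m) n = begin
  ∑[ j < n ] f 0 j + ∑[ i < m ] ∑[ j < n ] f (suc i) j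
    ≡⟨ cong (_+_ (∑[ j < n ] f 0 j)) (∑-comm (f ∘ suc) m n) ⟩
  ∑[ j < n ] f 0 j + ∑[ j < n ] ∑[ i < m ] f (suc i) j
    ≡⟨ ∑-distrib-+ (f 0) (λ j → ∑[ i < m ] f (suc i) j) n ⟨
  ∑[ j < n ] ∑[ i < suc m ] f i j
    ∎
  where open ≡-Reasoning

∑-blocks : ∀ f m n → ∑[ i < m * n ] f i ≡ ∑[ q < m ] ∑[ r < n ] f (q * n + r)
∑-blocks f zero    n = refl
∑-blocks f (suc m) n = begin
  ∑[ i < n + m * n ] f i
    ≡⟨ ∑-+ f n (m * n) ⟩
  ∑[ r < n ] f r + ∑[ i < m * n ] f (n + i)
    ≡⟨ cong (_+_ (∑[ r < n ] f r)) (∑-blocks (λ i → f (n + i)) m n) ⟩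
  ∑[ r < n ] f r + ∑[ q < m ] ∑[ r < n ] f (n + (q * n + r))
    ≡⟨ cong (_+_ (∑[ r < n ] f r)) (∑-cong m λ q → ∑-cong n λ r → cong f (sym (+-assoc n (q * n) r))) ⟩
  ∑[ q < suc m ] ∑[ r < n ] f (q * n + r)
    ∎
  where open ≡-Reasoning

∑-last : ∀ f n → ∑[ i < suc n ] f i ≡ ∑[ i < n ] f i + f n
∑-last f zero    = +-comm (f 0) 0
∑-last f (suc n) = trans (cong (_+_ (f 0)) (∑-last (f ∘ suc) n)) (sym (+-assoc (f 0) _ _))

∑-rotate : ∀ f n → f n ≡ f 0 → ∑[ i < n ] f (suc i) ≡ ∑[ i < n ] f i
∑-rotate f n fn≡f0 = +-cancelˡ-≡ (f 0) _ _ (begin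
  ∑[ i < suc n ] f i    ≡⟨ ∑-last f n ⟩
  ∑[ i < n ] f i + f n  ≡⟨ cong (_+_ (∑[ i < n ] f i)) fn≡f0 ⟩
  ∑[ i < n ] f i + f 0  ≡⟨ +-comm _ (f 0) ⟩
  f 0 + ∑[ i < n ] f i  ∎)
  where open ≡-Reasoning

Periodic : ℕ → (ℕ → ℕ) → Set
Periodic n f = ∀ i → f (i + n) ≡ f i

periodic-* : ∀ {n} {f : ℕ → ℕ} → Periodic n f → ∀ c i → f (i + c * n) ≡ f i
periodic-* {n} {f} per zero    i = cong f (+-identityʳ i)
periodic-* {n} {f} per (suc c) i = begin
  f (i + (n + c * n))  ≡⟨ cong f (+-assoc i n (c * n)) ⟨
  f (i + n + c * n)    ≡⟨ periodic-* per c (i + n) ⟩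
  f (i + n)            ≡⟨ per i ⟩
  f i                  ∎
  where open ≡-Reasoning

∑-shift : ∀ {n} {f : ℕ → ℕ} → Periodic n f → ∀ c → ∑[ i < n ] f (c + i) ≡ ∑[ i < n ] f i
∑-shift         per zero    = refl
∑-shift {n} {f} per (suc c) = trans (∑-shift (per ∘ suc) c) (∑-rotate f n (per 0))

∑-periodic : ∀ {n} {f : ℕ → ℕ} → Periodic n f → ∀ m →
             ∑[ i < m * n ] f i ≡ m * ∑[ i < n ] f i
∑-periodic {n} {f} per m = begin
  ∑[ i < m * n ] f i                   ≡⟨ ∑-blocks f m n ⟩
  ∑[ q < m ] ∑[ r < n ] f (q * n + r)  ≡⟨ ∑-cong m (λ q → ∑-shift per (q * n)) ⟩
  ∑[ q < m ] ∑[ r < n ] f r            ≡⟨ ∑-const m _ ⟩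
  m * ∑[ i < n ] f i                   ∎
  where open ≡-Reasoning

periodic-step : ∀ {p q} {f : ℕ → ℕ} a b → 1 + a * p ≡ b * q →
                Periodic p f → Periodic q f → ∀ i → f (suc i) ≡ f i
periodic-step {p} {q} {f} a b 1+ap≡bq p-periodic q-periodic i = begin
  f (suc i)          ≡⟨ periodic-* p-periodic a (suc i) ⟨
  f (suc i + a * p)  ≡⟨ cong f (trans (sym (+-suc i (a * p))) (cong (_+_ i) 1+ap≡bq)) ⟩
  f (i + b * q)      ≡⟨ periodic-* q-periodic b i ⟩
  f i                ∎
  where open ≡-Reasoning

periodic-coprime⇒constant : ∀ {m n} {f : ℕ → ℕ} → Coprime m n →
                            Periodic m f → Periodic n f → ∀ i → f i ≡ f 0
periodic-coprime⇒constant m⊥n perₘ perₙ zero    = refl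
periodic-coprime⇒constant {f = f} m⊥n perₘ perₙ (suc i) =
  trans step (periodic-coprime⇒constant m⊥n perₘ perₙ i)
  where
  step : f (suc i) ≡ f i
  step with coprime-Bézout m⊥n
  ... | Bézout.+- x y 1+yn≡xm = periodic-step y x 1+yn≡xm perₙ perₘ i
  ... | Bézout.-+ x y 1+xm≡yn = periodic-step x y 1+xm≡yn perₘ perₙ i

-- The sums h r over the progression q * n + r are periodic in r modulo m and modulo n, hence
-- constant; summing h over a full period identifies the constant.
∑-progression : ∀ {m n} {f : ℕ → ℕ} → Coprime m n → Periodic m f →
                ∀ r → ∑[ q < m ] f (q * n + r) ≡ ∑[ i < m ] f i
∑-progression {zero}                m⊥n per r = refl
∑-progression {m@(suc _)} {n} {f} m⊥n per r = begin
  h r             ≡⟨ h-constant r ⟩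
  h 0             ≡⟨ *-cancelˡ-≡ (h 0) (∑[ i < m ] f i) m m*h0≡m*∑f ⟩
  ∑[ i < m ] f i  ∎
  where
  open ≡-Reasoning
  h : ℕ → ℕ
  h r = ∑[ q < m ] f (q * n + r)
  h-periodicₘ : Periodic m h
  h-periodicₘ r = ∑-cong m λ q → trans (cong f (sym (+-assoc (q * n) r m))) (per (q * n + r))
  shift-q : ∀ q n r → q * n + (r + n) ≡ (1 + q) * n + r
  shift-q = ℕ-Solver.solve-∀
  wrap-around : ∀ r → f (m * n + r) ≡ f r
  wrap-around r = trans (cong f (trans (+-comm (m * n) r) (cong (_+_ r) (*-comm m n)))) (periodic-* per n r)
  h-periodicₙ : Periodic n h
  h-periodicₙ r = begin
    ∑[ q < m ] f (q * n + (r + n))  ≡⟨ ∑-cong m (λ q → cong f (shift-q q n r)) ⟩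
    ∑[ q < m ] f (suc q * n + r)    ≡⟨ ∑-rotate (λ q → f (q * n + r)) m (wrap-around r) ⟩
    h r                             ∎
  h-constant : ∀ r → h r ≡ h 0
  h-constant = periodic-coprime⇒constant m⊥n h-periodicₘ h-periodicₙ
  m*h0≡m*∑f : m * h 0 ≡ m * ∑[ i < m ] f i
  m*h0≡m*∑f = begin
    m * h 0                              ≡⟨ ∑-const m (h 0) ⟨
    ∑[ r < m ] h 0                       ≡⟨ ∑-cong m h-constant ⟨
    ∑[ r < m ] ∑[ q < m ] f (q * n + r)  ≡⟨ ∑-comm (λ r q → f (q * n + r)) m m ⟩
    ∑[ q < m ] ∑[ r < m ] f (q * n + r)  ≡⟨ ∑-cong m (λ q → ∑-shift per (q * n)) ⟩
    ∑[ q < m ] ∑[ i < m ] f i            ≡⟨ ∑-const m _ ⟩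
    m * ∑[ i < m ] f i                   ∎

∑-coprime-product : ∀ {m n} {f g : ℕ → ℕ} → Coprime m n → Periodic m f → Periodic n g →
                    ∑[ i < m * n ] (f i * g i) ≡ ∑[ i < m ] f i * ∑[ i < n ] g i
∑-coprime-product {m} {n} {f} {g} m⊥n perf perg = begin
  ∑[ i < m * n ] (f i * g i)
    ≡⟨ ∑-blocks (λ i → f i * g i) m n ⟩
  ∑[ q < m ] ∑[ r < n ] (f (q * n + r) * g (q * n + r))
    ≡⟨ ∑-cong m (λ q → ∑-cong n λ r → cong (f (q * n + r) *_) (g-block q r)) ⟩
  ∑[ q < m ] ∑[ r < n ] (f (q * n + r) * g r)
    ≡⟨ ∑-comm (λ q r → f (q * n + r) * g r) m n ⟩
  ∑[ r < n ] ∑[ q < m ] (f (q * n + r) * g r)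
    ≡⟨ ∑-cong n (λ r → ∑-*ʳ (λ q → f (q * n + r)) (g r) m) ⟩
  ∑[ r < n ] ((∑[ q < m ] f (q * n + r)) * g r)
    ≡⟨ ∑-cong n (λ r → cong (_* g r) (∑-progression m⊥n perf r)) ⟩
  ∑[ r < n ] ((∑[ i < m ] f i) * g r)
    ≡⟨ ∑-*ˡ (∑[ i < m ] f i) g n ⟩
  ∑[ i < m ] f i * ∑[ i < n ] g i
    ∎
  where
  open ≡-Reasoning
  g-block : ∀ q r → g (q * n + r) ≡ g r
  g-block q r = trans (cong g (+-comm (q * n) r)) (periodic-* perg q r)

periodic-product : ∀ {A : Set} (M : A → ℕ) (χ : A → ℕ → ℕ) xs →
                   All (λ a → Periodic (M a) (χ a)) xs →
                   Periodic (product (map M xs)) (λ i → product (map (λ a → χ a i) xs))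
periodic-product M χ []       []           i = refl
periodic-product M χ (a ∷ xs) (per ∷ pers) i = cong₂ _*_
  (trans (cong (λ j → χ a (i + j)) (*-comm (M a) (product (map M xs)))) (periodic-* per (product (map M xs)) i))
  (periodic-* (periodic-product M χ xs pers) (M a) i)

∑-product-coprime : ∀ {A : Set} (M : A → ℕ) (χ : A → ℕ → ℕ) xs →
                    AllPairs (λ a b → Coprime (M a) (M b)) xs → All (λ a → Periodic (M a) (χ a)) xs →
                    ∑[ i < product (map M xs) ] product (map (λ a → χ a i) xs)
                    ≡ product (map (λ a → ∑[ i < M a ] χ a i) xs)
∑-product-coprime M χ []       []               []           = refl
∑-product-coprime M χ (a ∷ xs) (a⊥xs ∷ coprime) (per ∷ pers) = trans
  (∑-coprime-product (coprime-product (Allₚ.map⁺ a⊥xs)) per (periodic-product M χ xs pers))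
  (cong (_*_ (∑[ i < M a ] χ a i)) (∑-product-coprime M χ xs coprime pers))

indicator : Bool → ℕ
indicator b = if b then 1 else 0

length-filter-applyUpTo : ∀ {A : Set} {P : A → Set} (P? : ∀ x → Dec (P x)) (g : ℕ → A) n →
                          length (filter P? (applyUpTo g n)) ≡ ∑[ i < n ] indicator (does (P? (g i)))
length-filter-applyUpTo P? g zero    = refl
length-filter-applyUpTo P? g (suc n) with does (P? (g 0))
... | true  = cong suc (length-filter-applyUpTo P? (g ∘ suc) n)
... | false = length-filter-applyUpTo P? (g ∘ suc) n

indicator-all : ∀ {A : Set} (f : A → Bool) xs → indicator (all f xs) ≡ product (map (indicator ∘ f) xs)
indicator-all f []       = refl
indicator-all f (x ∷ xs) with f x
... | true  = trans (indicator-all f xs) (sym (+-identityʳ _))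
... | false = refl

-- A record rather than an abbreviation of + n ∣ x - y, so that x and y can be inferred.
infix 4 _≡_[mod_]
record _≡_[mod_] (x y : ℤ) (n : ℕ) : Set where
  constructor divides-difference
  field n∣x-y : + n ∣ℤ x ℤ.- y

≡-mod-sym : ∀ {x y n} → x ≡ y [mod n ] → y ≡ x [mod n ]
≡-mod-sym {x} {y} (divides-difference n∣x-y) =
  divides-difference (subst (_ ∣ℤ_) (negate x y) (ℤ∣.∣m⇒∣-m n∣x-y))
  where
  negate : ∀ x y → ℤ.- (x ℤ.- y) ≡ y ℤ.- x
  negate = ℤ-Solver.solve-∀

≡-mod-weaken : ∀ {x y m n} → m ∣ n → x ≡ y [mod n ] → x ≡ y [mod m ]
≡-mod-weaken m∣n (divides-difference n∣x-y) = divides-difference (ℤ∣.∣-trans (∣ᵤ⇒∣ m∣n) n∣x-y)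

∣-resp-≡-mod : ∀ {x y m n} → m ∣ n → x ≡ y [mod n ] → m ∣ ∣ y ∣ → m ∣ ∣ x ∣
∣-resp-≡-mod {x} {y} m∣n x≡y m∣y with ≡-mod-weaken m∣n x≡y
... | divides-difference m∣x-y =
  ∣⇒∣ᵤ (subst (_ ∣ℤ_) (cancel x y) (ℤ∣.∣m∣n⇒∣m+n m∣x-y (∣ᵤ⇒∣ m∣y)))
  where
  cancel : ∀ x y → x ℤ.- y ℤ.+ y ≡ x
  cancel = ℤ-Solver.solve-∀

small-multiple≡0 : ∀ {n k} → n ∣ k → k < n → k ≡ 0
small-multiple≡0 {k = zero}  _   _   = refl
small-multiple≡0 {k = suc _} n∣k k<n = contradiction n∣k (>⇒∤ k<n)

modZ-cong : ∀ {x y n} → x ≡ y [mod n ] → modZ x n ≡ modZ y n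
modZ-cong {n = zero}          _                           = refl
modZ-cong {x} {y} {n@(suc _)} (divides-difference n∣x-y) =
  ℤ.+-injective (ℤ.i-j≡0⇒i≡j _ _ (ℤ.∣i∣≡0⇒i≡0 (small-multiple≡0 (∣⇒∣ᵤ n∣r-r′) |r-r′|<n)))
  where
  r r′ : ℕ
  r  = x ℤ.%ℕ n
  r′ = y ℤ.%ℕ n
  remainder-difference : ∀ r r′ q q′ n →
                         (r ℤ.+ q ℤ.* n) ℤ.- (r′ ℤ.+ q′ ℤ.* n) ℤ.- (q ℤ.- q′) ℤ.* n ≡ r ℤ.- r′
  remainder-difference = ℤ-Solver.solve-∀
  n∣r-r′ : + n ∣ℤ + r ℤ.- + r′
  n∣r-r′ = subst (_ ∣ℤ_)
    (trans (cong₂ (λ a b → a ℤ.- b ℤ.- (x ℤ./ℕ n ℤ.- y ℤ./ℕ n) ℤ.* + n)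
                  (a≡a%ℕn+[a/ℕn]*n x n) (a≡a%ℕn+[a/ℕn]*n y n))
           (remainder-difference (+ r) (+ r′) (x ℤ./ℕ n) (y ℤ./ℕ n) (+ n)))
    (ℤ∣.∣m∣n⇒∣m-n n∣x-y (ℤ∣.∣n⇒∣m*n (x ℤ./ℕ n ℤ.- y ℤ./ℕ n) ℤ∣.∣-refl))
  |r-r′|<n : ∣ + r ℤ.- + r′ ∣ < n
  |r-r′|<n = subst (λ i → ∣ i ∣ < n) (sym (ℤ.[+m]-[+n]≡m⊖n r r′))
    (≤-<-trans (ℤ.∣m⊝n∣≤m⊔n r r′) (⊔-lub (n%ℕd<d x n) (n%ℕd<d y n)))

divZ-* : ∀ {x m} .{{_ : NonZero m}} → m ∣ ∣ x ∣ → divZ x m ℤ.* + m ≡ x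
divZ-* {x} {m@(suc _)} (divides q |x|≡q*m) = begin
  (sign x ◃ divN ∣ x ∣ m) ℤ.* + m     ≡⟨ cong₂ (λ a b → (sign x ◃ a) ℤ.* b) |x|/m≡q (sym (ℤ.+◃n≡+n m)) ⟩
  (sign x ◃ q) ℤ.* (Sign.+ ◃ m)      ≡⟨ ℤ.◃-distrib-* (sign x) Sign.+ q m ⟨
  (sign x Sign.* Sign.+) ◃ (q * m)   ≡⟨ cong₂ _◃_ (Sign.*-identityʳ (sign x)) (sym |x|≡q*m) ⟩
  sign x ◃ ∣ x ∣                      ≡⟨ ℤ.◃-inverse x ⟩
  x                                   ∎
  where
  open ≡-Reasoning
  |x|/m≡q : divN ∣ x ∣ m ≡ q
  |x|/m≡q = trans (cong (_/ m) |x|≡q*m) (m*n/n≡m q m)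

divZ-cong : ∀ {x y m q} .{{_ : NonZero m}} → m ∣ ∣ x ∣ → m ∣ ∣ y ∣ →
            x ≡ y [mod m * q ] → divZ x m ≡ divZ y m [mod q ]
divZ-cong {x} {y} {m} {q} m∣x m∣y (divides-difference mq∣x-y) =
  divides-difference (ℤ∣.*-cancelʳ-∣ (+ m) (subst₂ _∣ℤ_ modulus difference mq∣x-y))
  where
  factor-out : ∀ a b m → a ℤ.* m ℤ.- b ℤ.* m ≡ (a ℤ.- b) ℤ.* m
  factor-out = ℤ-Solver.solve-∀
  modulus : + (m * q) ≡ + q ℤ.* + m
  modulus = trans (ℤ.pos-* m q) (ℤ.*-comm (+ m) (+ q))
  difference : x ℤ.- y ≡ (divZ x m ℤ.- divZ y m) ℤ.* + m
  difference = trans (sym (cong₂ ℤ._-_ (divZ-* m∣x) (divZ-* m∣y))) (factor-out (divZ x m) (divZ y m) (+ m))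

-- Local behaviour of v_{l,k}

if-dec-cong : ∀ {A B C : Set} {x x′ y y′ : C} (a? : Dec A) (b? : Dec B) → (A → B) → (B → A) →
              (A → x ≡ x′) → (¬ A → y ≡ y′) →
              (if does a? then x else y) ≡ (if does b? then x′ else y′)
if-dec-cong (yes a) (yes _) _  _    x≡x′ _    = x≡x′ a
if-dec-cong (no ¬a) (no _)  _  _    _    y≡y′ = y≡y′ ¬a
if-dec-cong (yes a) (no ¬b) to _    _    _    = contradiction (to a) ¬b
if-dec-cong (no ¬a) (yes b) _  from _    _    = contradiction (from b) ¬a

∧-dec-cong : ∀ {A B : Set} {c c′ : Bool} (a? : Dec A) (b? : Dec B) → (A → B) → (B → A) →
             (A → c ≡ c′) → does a? ∧ c ≡ does b? ∧ c′
∧-dec-cong (yes a) (yes _) _  _    c≡c′ = c≡c′ a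
∧-dec-cong (no _)  (no _)  _  _    _    = refl
∧-dec-cong (yes a) (no ¬b) to _    _    = contradiction (to a) ¬b
∧-dec-cong (no ¬a) (yes b) _  from _    = contradiction (from b) ¬a

∧-dec-false : ∀ {A : Set} {c : Bool} (a? : Dec A) → ¬ A → does a? ∧ c ≡ false
∧-dec-false (yes a) ¬a = contradiction a ¬a
∧-dec-false (no _)  _  = refl

largestUpTo-≤ : ∀ P n → largestUpTo P n ≤ n
largestUpTo-≤ P zero    = z≤n
largestUpTo-≤ P (suc n) with P (suc n)
... | true  = ≤-refl
... | false = m≤n⇒m≤1+n (largestUpTo-≤ P n)

largestUpTo-spec : ∀ P n → largestUpTo P n ≡ 0 ⊎ P (largestUpTo P n) ≡ true
largestUpTo-spec P zero    = inj₁ refl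
largestUpTo-spec P (suc n) with P (suc n) in Pn
... | true  = inj₂ Pn
... | false = largestUpTo-spec P n

largestUpTo-cong : ∀ {P Q} n → (∀ d → d ≤ n → P d ≡ Q d) → largestUpTo P n ≡ largestUpTo Q n
largestUpTo-cong zero    P≗Q = refl
largestUpTo-cong (suc n) P≗Q = cong₂ (λ b r → if b then suc n else r)
  (P≗Q (suc n) ≤-refl) (largestUpTo-cong n λ d d≤n → P≗Q d (m≤n⇒m≤1+n d≤n))

largestUpTo-stable : ∀ P {m} n → (∀ d → m < d → P d ≡ false) → m ≤ n →
                     largestUpTo P n ≡ largestUpTo P m
largestUpTo-stable P n false-above m≤n with m≤n⇒m<n∨m≡n m≤n
... | inj₂ refl = refl
largestUpTo-stable P (suc n) false-above m≤n | inj₁ m<1+n =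
  trans (cong (λ b → if b then suc n else largestUpTo P n) (false-above (suc n) m<1+n))
        (largestUpTo-stable P n false-above (≤-pred m<1+n))

δ-ok-false : ∀ {l Δ d} → ¬ l ^ (2 * d) ∣ ∣ Δ ∣ → δ-ok l Δ d ≡ false
δ-ok-false {l} {Δ} {d} = ∧-dec-false (l ^ (2 * d) ∣? ∣ Δ ∣)

δ≡largestUpTo : ∀ {l k Δ} → 2 ≤ l → ¬ l ^ (2 * suc k) ∣ ∣ Δ ∣ →
                δ l Δ ≡ largestUpTo (δ-ok l Δ) k
δ≡largestUpTo {l} {k} {Δ} 2≤l l^2k∤Δ with ≤-total ∣ Δ ∣ k
... | inj₁ |Δ|≤k =
  sym (largestUpTo-stable (δ-ok l Δ) k (λ d |Δ|<d → δ-ok-false {l} {Δ} {d} (too-large |Δ|<d)) |Δ|≤k)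
  where
  instance
    _ : NonZero ∣ Δ ∣
    _ = ≢-nonZero λ |Δ|≡0 → l^2k∤Δ (subst (_ ∣_) (sym |Δ|≡0) (_ ∣0))
  too-large : ∀ {d} → ∣ Δ ∣ < d → ¬ l ^ (2 * d) ∣ ∣ Δ ∣
  too-large {d} |Δ|<d = >⇒∤ (begin-strict
    ∣ Δ ∣        <⟨ <-trans |Δ|<d (n<2^n d) ⟩
    2 ^ d        ≤⟨ ^-monoʳ-≤ 2 (m≤n*m d 2) ⟩
    2 ^ (2 * d)  ≤⟨ ^-monoˡ-≤ (2 * d) 2≤l ⟩
    l ^ (2 * d)  ∎)
    where open ≤-Reasoning
... | inj₂ k≤|Δ| =
  largestUpTo-stable (δ-ok l Δ) ∣ Δ ∣ (λ d k<d → δ-ok-false {l} {Δ} {d} (too-divisible k<d)) k≤|Δ|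
  where
  too-divisible : ∀ {d} → k < d → ¬ l ^ (2 * d) ∣ ∣ Δ ∣
  too-divisible k<d l^2d∣Δ = l^2k∤Δ (∣-trans (^-monoʳ-∣ l (*-monoʳ-≤ 2 k<d)) l^2d∣Δ)

δ<k : ∀ {l k Δ} → 2 ≤ l → ¬ l ^ (2 * k) ∣ ∣ Δ ∣ → δ l Δ < k
δ<k {k = zero}  {Δ} _   l^0∤Δ  = contradiction (1∣ ∣ Δ ∣) l^0∤Δ
δ<k {l} {suc k} {Δ} 2≤l l^2k∤Δ =
  s≤s (subst (_≤ k) (sym (δ≡largestUpTo {l} {k} {Δ} 2≤l l^2k∤Δ)) (largestUpTo-≤ _ k))

l^2δ∣Δ : ∀ l Δ → l ^ (2 * δ l Δ) ∣ ∣ Δ ∣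
l^2δ∣Δ l Δ =
  [ (λ δ≡0 → subst (λ d → l ^ (2 * d) ∣ ∣ Δ ∣) (sym δ≡0) (1∣ ∣ Δ ∣))
  , (λ δ-ok≡true → invert (subst (Reflects _) (∧-conicalˡ (does l^2δ∣?Δ) _ δ-ok≡true) (proof l^2δ∣?Δ)))
  ]′ (largestUpTo-spec (δ-ok l Δ) ∣ Δ ∣)
  where
  l^2δ∣?Δ : Dec (l ^ (2 * δ l Δ) ∣ ∣ Δ ∣)
  l^2δ∣?Δ = l ^ (2 * δ l Δ) ∣? ∣ Δ ∣

2d+2≤2k : ∀ {d k} → d < k → 2 * d + 2 ≤ 2 * k
2d+2≤2k {d} d<k = ≤-trans (≤-reflexive (trans (+-comm (2 * d) 2) (sym (*-suc 2 d)))) (*-monoʳ-≤ 2 d<k)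

divZ-cong-^ : ∀ {l Δ Δ′ d b n} → 2 ≤ l → 2 * d + b ≤ n →
              l ^ (2 * d) ∣ ∣ Δ ∣ → l ^ (2 * d) ∣ ∣ Δ′ ∣ → Δ ≡ Δ′ [mod l ^ n ] →
              divZ Δ (l ^ (2 * d)) ≡ divZ Δ′ (l ^ (2 * d)) [mod l ^ b ]
divZ-cong-^ {l} {d = d} 2≤l 2d+b≤n m∣Δ m∣Δ′ Δ≡Δ′ =
  divZ-cong m∣Δ m∣Δ′ (≡-mod-weaken (^-*-^-∣ l {2 * d} 2d+b≤n) Δ≡Δ′)
  where
  instance
    _ : NonZero (l ^ (2 * d))
    _ = m^n≢0 l (2 * d) {{≢-nonZero (m<n⇒n≢0 2≤l)}}

δ-ok-cong : ∀ {l k Δ Δ′ d} → 2 ≤ l → d < k → Δ ≡ Δ′ [mod l ^ (2 * k) ] →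
            δ-ok l Δ d ≡ δ-ok l Δ′ d
δ-ok-cong {l} {k} {Δ} {Δ′} {d} 2≤l d<k Δ≡Δ′ =
  ∧-dec-cong (m ∣? ∣ Δ ∣) (m ∣? ∣ Δ′ ∣) m∣Δ⇒m∣Δ′ m∣Δ′⇒m∣Δ λ m∣Δ →
  if-dec-cong (l ≟ 2) (l ≟ 2) id id
    (λ l≡2 → cong (λ r → (r ≡ᵇ 0) ∨ (r ≡ᵇ 1)) (modZ-cong (quotients-mod-4 m∣Δ l≡2)))
    (λ _ → refl)
  where
  m : ℕ
  m = l ^ (2 * d)
  m∣l^2k : m ∣ l ^ (2 * k)
  m∣l^2k = ^-monoʳ-∣ l (*-monoʳ-≤ 2 (<⇒≤ d<k))
  m∣Δ⇒m∣Δ′ : m ∣ ∣ Δ ∣ → m ∣ ∣ Δ′ ∣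
  m∣Δ⇒m∣Δ′ = ∣-resp-≡-mod m∣l^2k (≡-mod-sym Δ≡Δ′)
  m∣Δ′⇒m∣Δ : m ∣ ∣ Δ′ ∣ → m ∣ ∣ Δ ∣
  m∣Δ′⇒m∣Δ = ∣-resp-≡-mod m∣l^2k Δ≡Δ′
  quotients-mod-4 : m ∣ ∣ Δ ∣ → l ≡ 2 → divZ Δ m ≡ divZ Δ′ m [mod 4 ]
  quotients-mod-4 m∣Δ l≡2 = subst (_≡_[mod_] (divZ Δ m) (divZ Δ′ m)) (cong (_^ 2) l≡2)
    (divZ-cong-^ {d = d} 2≤l (2d+2≤2k d<k) m∣Δ (m∣Δ⇒m∣Δ′ m∣Δ) Δ≡Δ′)

δ-cong : ∀ {l k Δ Δ′} → 2 ≤ l → ¬ l ^ (2 * k) ∣ ∣ Δ ∣ → ¬ l ^ (2 * k) ∣ ∣ Δ′ ∣ →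
         Δ ≡ Δ′ [mod l ^ (2 * k) ] → δ l Δ ≡ δ l Δ′
δ-cong {k = zero}  {Δ} _ l^0∤Δ _ _ = contradiction (1∣ ∣ Δ ∣) l^0∤Δ
δ-cong {l} {suc k} {Δ} {Δ′} 2≤l l^2k∤Δ l^2k∤Δ′ Δ≡Δ′ = begin
  δ l Δ                      ≡⟨ δ≡largestUpTo {l} {k} {Δ} 2≤l l^2k∤Δ ⟩
  largestUpTo (δ-ok l Δ) k   ≡⟨ largestUpTo-cong k (λ d d≤k → δ-ok-cong 2≤l (s≤s d≤k) Δ≡Δ′) ⟩
  largestUpTo (δ-ok l Δ′) k  ≡⟨ δ≡largestUpTo {l} {k} {Δ′} 2≤l l^2k∤Δ′ ⟨
  δ l Δ′                     ∎
  where open ≡-Reasoning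

-- The two branches of kronecker D l, as functions of D modulo 8, resp. modulo l.
kronecker₂ : ℕ → ℤ
kronecker₂ r = if (r ≡ᵇ 1) ∨ (r ≡ᵇ 7) then + 1 else if (r ≡ᵇ 3) ∨ (r ≡ᵇ 5) then - + 1 else + 0

legendre : ℕ → ℕ → ℤ
legendre l r = if r ≡ᵇ 0 then + 0 else if any (λ x → modN (x * x) l ≡ᵇ r) (upTo l) then + 1 else - + 1

kronecker-cong : ∀ {D D′ l} → (l ≡ 2 → D ≡ D′ [mod 8 ]) → (l ≢ 2 → D ≡ D′ [mod l ]) →
                 kronecker D l ≡ kronecker D′ l
kronecker-cong {l = l} D≡D′₈ D≡D′ₗ = if-dec-cong (l ≟ 2) (l ≟ 2) id id
  (λ l≡2 → cong kronecker₂ (modZ-cong (D≡D′₈ l≡2)))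
  (λ l≢2 → cong (legendre l) (modZ-cong (D≡D′ₗ l≢2)))

κ-cong : ∀ {l k Δ Δ′ d} → 2 ≤ l → d < k → l ^ (2 * d) ∣ ∣ Δ ∣ → l ^ (2 * d) ∣ ∣ Δ′ ∣ →
         Δ ≡ Δ′ [mod l ^ (2 * k) ] → (l ≡ 2 → Δ ≡ Δ′ [mod l ^ suc (2 * k) ]) →
         kronecker (divZ Δ (l ^ (2 * d))) l ≡ kronecker (divZ Δ′ (l ^ (2 * d))) l
κ-cong {l} {k} {Δ} {Δ′} {d} 2≤l d<k m∣Δ m∣Δ′ Δ≡Δ′ Δ≡Δ′₂ = kronecker-cong
  (λ l≡2 → subst (_≡_[mod_] D D′) (cong (_^ 3) l≡2)
                 (divZ-cong-^ {d = d} 2≤l 2d+3≤2k+1 m∣Δ m∣Δ′ (Δ≡Δ′₂ l≡2)))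
  (λ _ → ≡-mod-weaken l∣l^1 (divZ-cong-^ {d = d} 2≤l 2d+1≤2k m∣Δ m∣Δ′ Δ≡Δ′))
  where
  D D′ : ℤ
  D  = divZ Δ (l ^ (2 * d))
  D′ = divZ Δ′ (l ^ (2 * d))
  2d+1≤2k : 2 * d + 1 ≤ 2 * k
  2d+1≤2k = ≤-trans (+-monoʳ-≤ (2 * d) (s≤s z≤n)) (2d+2≤2k d<k)
  2d+3≤2k+1 : 2 * d + 3 ≤ suc (2 * k)
  2d+3≤2k+1 = ≤-trans (≤-reflexive (+-suc (2 * d) 2)) (s≤s (2d+2≤2k d<k))
  l∣l^1 : l ∣ l ^ 1
  l∣l^1 = divides 1 (*-comm l 1)

-- v l Δ is vFromLocalData l (δ l Δ) κ by definition, where κ is the Kronecker symbol of Δ / l^{2δ}.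
vFromLocalData : ℕ → ℕ → ℤ → ℚ
vFromLocalData l d κ = factor l ℚ.* (1ℚ ℚ.+ inv (lQ l) ℚ.+ c)
  where
  c : ℚ
  c = if does (κ ℤ.≟ + 1) then 0ℚ
      else if does (κ ℤ.≟ + 0)
           then ℚ.- (lQ (l + 1) ℚ.* lpowInv l (d + 2))
           else ℚ.- (fromZ (+ 2) ℚ.* lpowInv l (d + 1))

v-cong : ∀ {l k Δ Δ′} → 2 ≤ l → ¬ l ^ (2 * k) ∣ ∣ Δ ∣ →
         Δ ≡ Δ′ [mod l ^ (2 * k) ] → (l ≡ 2 → Δ ≡ Δ′ [mod l ^ suc (2 * k) ]) → v l Δ ≡ v l Δ′
v-cong {l} {k} {Δ} {Δ′} 2≤l l^2k∤Δ Δ≡Δ′ Δ≡Δ′₂ = cong₂ (vFromLocalData l) δ≡δ′ κ≡κ′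
  where
  l^2k∤Δ′ : ¬ l ^ (2 * k) ∣ ∣ Δ′ ∣
  l^2k∤Δ′ = l^2k∤Δ ∘ ∣-resp-≡-mod ∣-refl Δ≡Δ′
  δ≡δ′ : δ l Δ ≡ δ l Δ′
  δ≡δ′ = δ-cong {l} {k} 2≤l l^2k∤Δ l^2k∤Δ′ Δ≡Δ′
  l^2δ∣Δ′ : l ^ (2 * δ l Δ) ∣ ∣ Δ′ ∣
  l^2δ∣Δ′ = subst (λ d → l ^ (2 * d) ∣ ∣ Δ′ ∣) (sym δ≡δ′) (l^2δ∣Δ l Δ′)
  κ≡κ′ : kronecker (divZ Δ (l ^ (2 * δ l Δ))) l ≡ kronecker (divZ Δ′ (l ^ (2 * δ l Δ′))) l
  κ≡κ′ = trans
    (κ-cong {l} {k} {Δ} {Δ′} {δ l Δ} 2≤l (δ<k {l} {k} {Δ} 2≤l l^2k∤Δ)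
            (l^2δ∣Δ l Δ) l^2δ∣Δ′ Δ≡Δ′ Δ≡Δ′₂)
    (cong (λ d → kronecker (divZ Δ′ (l ^ (2 * d))) l) δ≡δ′)

v-k-cong : ∀ {l k Δ Δ′} → 2 ≤ l → Δ ≡ Δ′ [mod l ^ (2 * k) ] →
           (l ≡ 2 → Δ ≡ Δ′ [mod l ^ suc (2 * k) ]) → v-k l k Δ ≡ v-k l k Δ′
v-k-cong {l} {k} {Δ} {Δ′} 2≤l Δ≡Δ′ Δ≡Δ′₂ =
  if-dec-cong (l ^ (2 * k) ∣? ∣ Δ ∣) (l ^ (2 * k) ∣? ∣ Δ′ ∣)
    (∣-resp-≡-mod ∣-refl (≡-mod-sym Δ≡Δ′)) (∣-resp-≡-mod ∣-refl Δ≡Δ′)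
    (λ _ → refl) (λ l^2k∤Δ → v-cong {l} {k} 2≤l l^2k∤Δ Δ≡Δ′ Δ≡Δ′₂)

disc-shift : ∀ p t u → disc p (t ℤ.+ + u) ≡ disc p t [mod u ]
disc-shift p t u = divides-difference
  (subst (_ ∣ℤ_) (sym (difference t (+ u) (+ (4 * p)))) (ℤ∣.∣n⇒∣m*n (+ 2 ℤ.* t ℤ.+ + u) ℤ∣.∣-refl))
  where
  difference : ∀ t u P → (t ℤ.+ u) ℤ.* (t ℤ.+ u) ℤ.- P ℤ.- (t ℤ.* t ℤ.- P) ≡ (+ 2 ℤ.* t ℤ.+ u) ℤ.* u
  difference = ℤ-Solver.solve-∀

disc-shift-even : ∀ p t u → 2 ∣ u → disc p (t ℤ.+ + u) ≡ disc p t [mod 2 * u ]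
disc-shift-even p t u (divides w refl) =
  divides-difference (subst₂ _∣ℤ_ (sym modulus) (sym difference) (ℤ∣.∣n⇒∣m*n (t ℤ.+ + w) ℤ∣.∣-refl))
  where
  modulus : + (2 * (w * 2)) ≡ + 2 ℤ.* (+ w ℤ.* + 2)
  modulus = trans (ℤ.pos-* 2 (w * 2)) (cong (+ 2 ℤ.*_) (ℤ.pos-* w 2))
  expand : ∀ t w P → (t ℤ.+ w ℤ.* + 2) ℤ.* (t ℤ.+ w ℤ.* + 2) ℤ.- P ℤ.- (t ℤ.* t ℤ.- P)
                     ≡ (t ℤ.+ w) ℤ.* (+ 2 ℤ.* (w ℤ.* + 2))
  expand = ℤ-Solver.solve-∀
  difference : disc p (t ℤ.+ + (w * 2)) ℤ.- disc p t ≡ (t ℤ.+ + w) ℤ.* (+ 2 ℤ.* (+ w ℤ.* + 2))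
  difference = trans (cong (λ v → disc p (t ℤ.+ v) ℤ.- disc p t) (ℤ.pos-* w 2)) (expand t (+ w) (+ (4 * p)))

v-k-periodic : ∀ {p l k u} t → 2 ≤ l → 1 ≤ k → l ^ (2 * k) ∣ u →
               v-k l k (disc p (t ℤ.+ + u)) ≡ v-k l k (disc p t)
v-k-periodic {p} {l} {k@(suc _)} {u} t 2≤l _ l^2k∣u = v-k-cong {l} {k} 2≤l
  (≡-mod-weaken l^2k∣u (disc-shift p t u))
  (λ l≡2 → ≡-mod-weaken (*-pres-∣ (∣-reflexive l≡2) l^2k∣u) (disc-shift-even p t u (2∣u l≡2)))
  where
  2∣u : l ≡ 2 → 2 ∣ u
  2∣u l≡2 = ∣-trans (subst (_∣ l ^ (2 * k)) l≡2 (m∣m*n _)) l^2k∣u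

primesBelow-member : ∀ a b {l} → l ∈ primesBelow a b → Prime l × l * b < a
primesBelow-member a b l∈ with ∈-filter⁻ prime? {xs = filter (λ l → l * b <? a) (upTo a)} l∈
... | l∈candidates , l-prime = l-prime , proj₂ (∈-filter⁻ (λ l → l * b <? a) {xs = upTo a} l∈candidates)

primesBelow-unique : ∀ a b → Unique (primesBelow a b)
primesBelow-unique a b = Unique.filter⁺ prime? (Unique.filter⁺ (λ l → l * b <? a) (Unique.upTo⁺ a))

primesBelow-primes : ∀ a b → All Prime (primesBelow a b)
primesBelow-primes a b = all-filter prime? (filter (λ l → l * b <? a) (upTo a))

periodT≡product : ∀ k a b → periodT k a b ≡ product (map (_^ (2 * k)) (primesBelow a b))
periodT≡product k a b = product-^ (primesBelow a b) (2 * k)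

^2k∣periodT : ∀ k a b {l} → l ∈ primesBelow a b → l ^ (2 * k) ∣ periodT k a b
^2k∣periodT k a b l∈ =
  subst (_ ∣_) (sym (periodT≡product k a b)) (∈⇒∣product (∈-map⁺ (_^ (2 * k)) l∈))

foldr-*-cong : ∀ {f g : ℕ → ℚ} {ls} → All (λ l → f l ≡ g l) ls →
               foldr (λ l acc → f l ℚ.* acc) 1ℚ ls ≡ foldr (λ l acc → g l ℚ.* acc) 1ℚ ls
foldr-*-cong []           = refl
foldr-*-cong (f≡g ∷ f≗g) = cong₂ ℚ._*_ f≡g (foldr-*-cong f≗g)

F-periodic : ∀ p k a b → 1 ≤ k → ∀ t → F p k a b (t ℤ.+ + periodT k a b) ≡ F p k a b t
F-periodic p k a b 1≤k t = foldr-*-cong {ls = primesBelow a b} (All.tabulate λ {l} l∈ →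
  v-k-periodic {p} {l} {k} t (prime≥2 (proj₁ (primesBelow-member a b l∈))) 1≤k (^2k∣periodT k a b l∈))

module WindowCounts (p k : ℕ) (s : ℤ) (x : ℕ → ℚ) where

  χ : ℕ → ℕ → ℕ
  χ l i = indicator (does (v-k l k (disc p (s ℤ.+ + i)) ℚ.≟ x l))

  shifted : ℕ → ℤ
  shifted i = s ℤ.+ + i

  countJoint-∑ : ∀ ls n → countJoint p k ls x (window s n) ≡ ∑[ i < n ] product (map (λ l → χ l i) ls)
  countJoint-∑ ls n = begin
    length (filter jointly? (map shifted (upTo n)))
      ≡⟨ cong (λ ts → length (filter jointly? ts)) (map-upTo shifted n) ⟩
    length (filter jointly? (applyUpTo shifted n))
      ≡⟨ length-filter-applyUpTo jointly? shifted n ⟩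
    ∑[ i < n ] indicator (all (hits (shifted i)) ls)
      ≡⟨ ∑-cong n (λ i → indicator-all (hits (shifted i)) ls) ⟩
    ∑[ i < n ] product (map (λ l → χ l i) ls)
      ∎
    where
    open ≡-Reasoning
    hits : ℤ → ℕ → Bool
    hits t l = does (v-k l k (disc p t) ℚ.≟ x l)
    jointly? : ∀ t → Dec (T (all (hits t) ls))
    jointly? t = T? (all (hits t) ls)

  countOne-∑ : ∀ l n → countOne p k l (x l) (window s n) ≡ ∑[ i < n ] χ l i
  countOne-∑ l n = trans (cong (λ ts → length (filter hits? ts)) (map-upTo shifted n))
                         (length-filter-applyUpTo hits? shifted n)
    where
    hits? : ∀ t → Dec (v-k l k (disc p t) ≡ x l)
    hits? t = v-k l k (disc p t) ℚ.≟ x l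

  χ-periodic : ∀ {l} → 1 ≤ k → Prime l → Periodic (l ^ (2 * k)) (χ l)
  χ-periodic {l} 1≤k l-prime i = cong (λ v → indicator (does (v ℚ.≟ x l))) (begin
    v-k l k (disc p (s ℤ.+ + (i + l ^ (2 * k))))
      ≡⟨ cong (λ t → v-k l k (disc p t)) shift ⟩
    v-k l k (disc p (s ℤ.+ + i ℤ.+ + l ^ (2 * k)))
      ≡⟨ v-k-periodic {p} {l} {k} {l ^ (2 * k)} (s ℤ.+ + i) (prime≥2 l-prime) 1≤k ∣-refl ⟩
    v-k l k (disc p (s ℤ.+ + i))
      ∎)
    where
    open ≡-Reasoning
    shift : s ℤ.+ + (i + l ^ (2 * k)) ≡ s ℤ.+ + i ℤ.+ + l ^ (2 * k)
    shift = trans (cong (ℤ._+_ s) (ℤ.pos-+ i _)) (sym (ℤ.+-assoc s (+ i) _))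

independence-identity : ∀ {A : Set} (xs : List A) (M q c : A → ℕ) N →
                        All (λ a → q a * M a ≡ N) xs → N ≡ product (map M xs) →
                        product (map c xs) * N ^ length xs ≡ N * product (map (λ a → q a * c a) xs)
independence-identity xs M q c N qM≡N N≡∏M = begin
  ∏ c * N ^ length xs                     ≡⟨ cong (_*_ (∏ c)) N^|xs| ⟩
  ∏ c * (∏ q * N)                         ≡⟨ rearrange (∏ c) (∏ q) N ⟩
  N * (∏ q * ∏ c)                         ≡⟨ cong (_*_ N) (product-map-* q c xs) ⟨
  N * product (map (λ a → q a * c a) xs)  ∎
  where
  open ≡-Reasoning
  ∏ : (_ → ℕ) → ℕ
  ∏ f = product (map f xs)
  rearrange : ∀ a b t → a * (b * t) ≡ t * (b * a)
  rearrange = ℕ-Solver.solve-∀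
  N^|xs| : N ^ length xs ≡ ∏ q * N
  N^|xs| = begin
    N ^ length xs                       ≡⟨ product-map-const N xs ⟨
    product (map (λ _ → N) xs)          ≡⟨ cong product (map-cong-local (All.map sym qM≡N)) ⟩
    product (map (λ a → q a * M a) xs)  ≡⟨ product-map-* q M xs ⟩
    ∏ q * ∏ M                           ≡⟨ cong (_*_ (∏ q)) N≡∏M ⟨
    ∏ q * N                             ∎

countJoint-independent : ∀ p k a b → 1 ≤ k → ∀ s x →
  countJoint p k (primesBelow a b) x (window s (periodT k a b)) * periodT k a b ^ length (primesBelow a b)
  ≡ periodT k a b * productOfCounts p k (primesBelow a b) x (window s (periodT k a b))
countJoint-independent p k a b 1≤k s x = begin
  countJoint p k L x (window s N) * N ^ length L
    ≡⟨ cong (_* N ^ length L) joint ⟩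
  product (map c L) * N ^ length L
    ≡⟨ independence-identity L M q c N qM≡N (periodT≡product k a b) ⟩
  N * product (map (λ l → q l * c l) L)
    ≡⟨ cong (λ ns → N * product ns) marginals ⟨
  N * productOfCounts p k L x (window s N)
    ∎
  where
  open ≡-Reasoning
  open WindowCounts p k s x
  L : List ℕ
  L = primesBelow a b
  N : ℕ
  N = periodT k a b
  M q c : ℕ → ℕ
  M l = l ^ (2 * k)
  q l = divN N (M l)
  c l = ∑[ i < M l ] χ l i
  qM≡N : All (λ l → q l * M l ≡ N) L
  qM≡N = All.tabulate λ l∈ → divN-* (^2k∣periodT k a b l∈)
  joint : countJoint p k L x (window s N) ≡ product (map c L)
  joint = begin
    countJoint p k L x (window s N)
      ≡⟨ countJoint-∑ L N ⟩
    ∑[ i < N ] product (map (λ l → χ l i) L)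
      ≡⟨ cong (λ n → ∑[ i < n ] product (map (λ l → χ l i) L)) (periodT≡product k a b) ⟩
    ∑[ i < product (map M L) ] product (map (λ l → χ l i) L)
      ≡⟨ ∑-product-coprime M χ L (coprime-prime-powers (2 * k) (primesBelow-unique a b) (primesBelow-primes a b))
                                 (All.map (χ-periodic 1≤k) (primesBelow-primes a b)) ⟩
    product (map c L)
      ∎
  marginal : ∀ {l} → l ∈ L → countOne p k l (x l) (window s N) ≡ q l * c l
  marginal {l} l∈ = begin
    countOne p k l (x l) (window s N)  ≡⟨ countOne-∑ l N ⟩
    ∑[ i < N ] χ l i                   ≡⟨ cong (λ n → ∑[ i < n ] χ l i) (All.lookup qM≡N l∈) ⟨
    ∑[ i < q l * M l ] χ l i           ≡⟨ ∑-periodic (χ-periodic 1≤k l-prime) (q l) ⟩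
    q l * c l                          ∎
    where
    l-prime : Prime l
    l-prime = proj₁ (primesBelow-member a b l∈)
  marginals : map (λ l → countOne p k l (x l) (window s N)) L ≡ map (λ l → q l * c l) L
  marginals = map-cong-local (All.tabulate marginal)

primesBelow-≤ : ∀ a b {l} .{{_ : NonZero b}} → l ∈ primesBelow a b → l ≤ a / b
primesBelow-≤ a b {l} l∈ =
  ≤-trans (≤-reflexive (sym (m*n/n≡m l b))) (/-monoˡ-≤ b (<⇒≤ (proj₂ (primesBelow-member a b l∈))))

product-primesBelow-≤ : ∀ a b .{{_ : NonZero b}} → product (primesBelow a b) ≤ 4 ^ (a / b)
product-primesBelow-≤ a b = ≤-trans (∣⇒≤ {{primorial≢0 (a / b)}} ∏∣primorial) (primorial-≤ (a / b))
  where
  ∏∣primorial : product (primesBelow a b) ∣ primorial (a / b)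
  ∏∣primorial = product-distinct-primes-∣ (primesBelow-unique a b) (primesBelow-primes a b)
    (All.tabulate λ l∈ → prime∣primorial (proj₁ (primesBelow-member a b l∈)) (primesBelow-≤ a b l∈))

periodT-bound : ∀ k a b .{{_ : NonZero b}} → periodT k a b ^ b ≤ 2 ^ (4 * k * a)
periodT-bound k a b = begin
  (product (primesBelow a b) ^ (2 * k)) ^ b  ≤⟨ ^-monoˡ-≤ b (^-monoˡ-≤ (2 * k) (product-primesBelow-≤ a b)) ⟩
  ((4 ^ n) ^ (2 * k)) ^ b                     ≡⟨ cong (_^ b) (^-*-assoc 4 n (2 * k)) ⟩
  (4 ^ (n * (2 * k))) ^ b                     ≡⟨ ^-*-assoc 4 (n * (2 * k)) b ⟩
  4 ^ (n * (2 * k) * b)                       ≡⟨ ^-*-assoc 2 2 (n * (2 * k) * b) ⟩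
  2 ^ (2 * (n * (2 * k) * b))                 ≡⟨ cong (2 ^_) (exponent n k b) ⟩
  2 ^ (4 * k * (n * b))                       ≤⟨ ^-monoʳ-≤ 2 (*-monoʳ-≤ (4 * k) (m/n*n≤m a b)) ⟩
  2 ^ (4 * k * a)                             ∎
  where
  open ≤-Reasoning
  n : ℕ
  n = a / b
  exponent : ∀ n k b → 2 * (n * (2 * k) * b) ≡ 4 * k * (n * b)
  exponent = ℕ-Solver.solve-∀

-- The bound holds with C = 1.
proposition4p10 :
    ((p k a b : ℕ) → Prime p → 1 ≤ k → 1 ≤ a → 1 ≤ b →
      ((t : ℤ) → F p k a b (t Data.Integer.+ + periodT k a b) ≡ F p k a b t)
      × ((s : ℤ) (x : ℕ → ℚ) →
          countJoint p k (primesBelow a b) x (window s (periodT k a b))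
            * periodT k a b ^ length (primesBelow a b)
          ≡ periodT k a b
            * productOfCounts p k (primesBelow a b) x (window s (periodT k a b))))
    × ∃ (λ (C : ℕ) → (k a b : ℕ) → 1 ≤ k → 1 ≤ a → 1 ≤ b →
        periodT k a b ^ b ≤ C ^ b * 2 ^ (4 * k * a))
proposition4p10 =
  (λ p k a b _ 1≤k _ _ → F-periodic p k a b 1≤k , countJoint-independent p k a b 1≤k)
  , 1 , λ k a b _ _ 1≤b →
          ≤-trans (periodT-bound k a b {{>-nonZero 1≤b}}) (≤-reflexive (sym (1^b*x≡x b)))
  where
  1^b*x≡x : ∀ b {x} → 1 ^ b * x ≡ x
  1^b*x≡x b {x} = trans (cong (_* x) (^-zeroˡ b)) (*-identityˡ x)
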